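{- Let $A_1$ be an $(M_1,N_1;\;m,n)_{k_1}$-sub-perfect map and $A_2$ be an $(M_2,N_2;\;m,n)_{k_2}$-sub-perfect map. Then there exists an $(M,N;\;m,n)_{k_1k_2}$-sub-perfect map with $M=\mathrm{lcm}(M_1,M_2)$ and $N=\mathrm{lcm}(N_1,N_2)$.
   Context: A cyclic array of shape $(M,N)$ over an alphabet $\Sigma$ of size $k$ is an array $A=(a_{i,j})$ with indices $(i,j)\in\mathbb{Z}_M\times\mathbb{Z}_N$ and entries in $\Sigma$; for each position $(i,j)$ the $(m,n)$-pattern of $A$ at $(i,j)$ is the $m\times n$ array $(a_{i+r,j+s})_{0\le r<m,\,0\le s<n}$ with indices taken modulo $M$ and $N$. $A$ is an $(M,N;\;m,n)_k$-sub-perfect map if no $(m,n)$-pattern occurs at two distinct positions of $A$. -}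

module Defs where

open import Data.Nat using (ℕ; _+_; _<_; NonZero)
open import Data.Nat.DivMod using (_mod_)
open import Data.Fin using (Fin; toℕ)
open import Data.Product using (_×_)
open import Relation.Binary.PropositionalEquality using (_≡_)

-- A cyclic array of shape (M,N) over an alphabet Σ of size k:
-- entries a(i,j) with (i,j) ∈ ℤ_M × ℤ_N (represented by Fin M × Fin N,
-- arithmetic taken modulo M and N), alphabet Σ represented by Fin k.
CyclicArray : (M N k : ℕ) → Set
CyclicArray M N k = Fin M → Fin N → Fin k

entryAt : ∀ {M N k} .{{_ : NonZero M}} .{{_ : NonZero N}} →
          CyclicArray M N k → Fin M → Fin N → ℕ → ℕ → Fin k
entryAt {M} {N} A i j r s = A ((toℕ i + r) mod M) ((toℕ j + s) mod N)

SamePattern : ∀ {M N k} .{{_ : NonZero M}} .{{_ : NonZero N}} →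
              (m n : ℕ) → CyclicArray M N k →
              Fin M → Fin N → Fin M → Fin N → Set
SamePattern m n A i j i' j' =
  ∀ r s → r < m → s < n → entryAt A i j r s ≡ entryAt A i' j' r s

SubPerfectMap : ∀ {M N k} .{{_ : NonZero M}} .{{_ : NonZero N}} →
                (m n : ℕ) → CyclicArray M N k → Set
SubPerfectMap m n A =
  ∀ i j i' j' → SamePattern m n A i j i' j' → (i ≡ i') × (j ≡ j')

{-# OPTIONS --safe #-}
-- Superimpose the periodic extensions of A₁ and A₂ to the lcm shape, pairing
-- the letters: A(i,j) = (A₁(i mod M₁, j mod N₁), A₂(i mod M₂, j mod N₂)).
-- Since M₁ and M₂ divide lcm(M₁,M₂), the (m,n)-pattern of A at (i,j) consists
-- of the patterns of A₁ and A₂ at the reduced positions, so it determines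
-- i and j modulo M₁, M₂, N₁, N₂; by the Chinese remainder theorem
-- (x ↦ (x mod M₁, x mod M₂) is injective on ℤ_lcm(M₁,M₂)) it determines (i,j).
module Submission where

open import Defs
open import Data.Nat using (ℕ; _*_; _+_; _∸_; _<_; NonZero)
open import Data.Nat.Properties
  using (≤-antisym; ≤-<-trans; m∸n≤m; m∸n≡0⇒m≤n; [m+n]∸[m+o]≡n∸o; *-distribʳ-∸)
open import Data.Nat.DivMod
  using (_%_; _mod_; m%n<n; m<n⇒m%n≡m; %-congˡ; m%n%n≡m%n; %-distribˡ-+;
         m≡m%n+[m/n]*n; _/_; m∣n⇒o%n%m≡o%m)
open import Data.Nat.Divisibility using (_∣_; divides; n∣m⇒m%n≡0)
open import Data.Nat.LCM using (lcm; m∣lcm[m,n]; n∣lcm[m,n]; lcm-least)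
open import Data.Fin using (Fin; toℕ; combine)
open import Data.Fin.Properties using (toℕ-injective; toℕ-fromℕ<; toℕ<n; combine-injective)
open import Data.Product using (Σ; _×_; _,_; proj₁; proj₂)
open import Relation.Binary.PropositionalEquality
  using (_≡_; sym; trans; cong; cong₂; module ≡-Reasoning)

open ≡-Reasoning

private
  variable
    M N L K k k₁ k₂ m n : ℕ

m%d≡n%d⇒d∣m∸n : ∀ m n d .{{_ : NonZero d}} → m % d ≡ n % d → d ∣ m ∸ n
m%d≡n%d⇒d∣m∸n m n d eq = divides (m / d ∸ n / d) (begin
  m ∸ n                                      ≡⟨ cong₂ _∸_ (m≡m%n+[m/n]*n m d) (m≡m%n+[m/n]*n n d) ⟩
  (m % d + m / d * d) ∸ (n % d + n / d * d)  ≡⟨ cong (λ t → (m % d + m / d * d) ∸ (t + n / d * d)) (sym eq) ⟩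
  (m % d + m / d * d) ∸ (m % d + n / d * d)  ≡⟨ [m+n]∸[m+o]≡n∸o (m % d) (m / d * d) (n / d * d) ⟩
  m / d * d ∸ n / d * d                      ≡⟨ *-distribʳ-∸ d (m / d) (n / d) ⟨
  (m / d ∸ n / d) * d                        ∎)

n∣m∧m<n⇒m≡0 : ∀ {m n} .{{_ : NonZero n}} → n ∣ m → m < n → m ≡ 0
n∣m∧m<n⇒m≡0 {m} {n} n∣m m<n = trans (sym (m<n⇒m%n≡m m<n)) (n∣m⇒m%n≡0 m n n∣m)

%-≡-below-lcm⇒≡ : ∀ {a b} d₁ d₂ .{{_ : NonZero d₁}} .{{_ : NonZero d₂}} .{{_ : NonZero (lcm d₁ d₂)}} →
                  a < lcm d₁ d₂ → b < lcm d₁ d₂ → a % d₁ ≡ b % d₁ → a % d₂ ≡ b % d₂ → a ≡ b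
%-≡-below-lcm⇒≡ {a} {b} d₁ d₂ a<l b<l eq₁ eq₂ =
  ≤-antisym (m∸n≡0⇒m≤n (difference≡0 a b a<l eq₁ eq₂))
            (m∸n≡0⇒m≤n (difference≡0 b a b<l (sym eq₁) (sym eq₂)))
  where
  difference≡0 : ∀ x y → x < lcm d₁ d₂ → x % d₁ ≡ y % d₁ → x % d₂ ≡ y % d₂ → x ∸ y ≡ 0
  difference≡0 x y x<l e₁ e₂ =
    n∣m∧m<n⇒m≡0 (lcm-least (m%d≡n%d⇒d∣m∸n x y d₁ e₁) (m%d≡n%d⇒d∣m∸n x y d₂ e₂))
                (≤-<-trans (m∸n≤m x y) x<l)

[m+n]%l%d≡[m%d+n]%d : ∀ m n l d .{{_ : NonZero l}} .{{_ : NonZero d}} → d ∣ l →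
                      (m + n) % l % d ≡ (m % d + n) % d
[m+n]%l%d≡[m%d+n]%d m n l d d∣l = begin
  (m + n) % l % d          ≡⟨ m∣n⇒o%n%m≡o%m d l (m + n) d∣l ⟩
  (m + n) % d              ≡⟨ %-distribˡ-+ m n d ⟩
  (m % d + n % d) % d      ≡⟨ cong (λ t → (t + n % d) % d) (m%n%n≡m%n m d) ⟨
  (m % d % d + n % d) % d  ≡⟨ %-distribˡ-+ (m % d) n d ⟨
  (m % d + n) % d          ∎

toℕ-mod : ∀ x d .{{_ : NonZero d}} → toℕ (x mod d) ≡ x % d
toℕ-mod x d = toℕ-fromℕ< (m%n<n x d)

reduce : ∀ d .{{_ : NonZero d}} → Fin L → Fin d
reduce d i = toℕ i mod d

toℕ-reduce : ∀ d .{{_ : NonZero d}} (i : Fin L) → toℕ (reduce d i) ≡ toℕ i % d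
toℕ-reduce d i = toℕ-mod (toℕ i) d

reduce-shift : ∀ d .{{_ : NonZero d}} .{{_ : NonZero L}} → d ∣ L → (i : Fin L) (r : ℕ) →
               reduce d ((toℕ i + r) mod L) ≡ (toℕ (reduce d i) + r) mod d
reduce-shift {L} d d∣L i r = toℕ-injective (begin
  toℕ (reduce d ((toℕ i + r) mod L))  ≡⟨ toℕ-reduce d ((toℕ i + r) mod L) ⟩
  toℕ ((toℕ i + r) mod L) % d         ≡⟨ %-congˡ (toℕ-mod (toℕ i + r) L) ⟩
  (toℕ i + r) % L % d                 ≡⟨ [m+n]%l%d≡[m%d+n]%d (toℕ i) r L d d∣L ⟩
  (toℕ i % d + r) % d                 ≡⟨ %-congˡ (cong (_+ r) (toℕ-reduce d i)) ⟨
  (toℕ (reduce d i) + r) % d          ≡⟨ toℕ-mod (toℕ (reduce d i) + r) d ⟨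
  toℕ ((toℕ (reduce d i) + r) mod d)  ∎)

reduce-injective : ∀ d₁ d₂ .{{_ : NonZero d₁}} .{{_ : NonZero d₂}} .{{_ : NonZero (lcm d₁ d₂)}}
                   {i i' : Fin (lcm d₁ d₂)} →
                   reduce d₁ i ≡ reduce d₁ i' → reduce d₂ i ≡ reduce d₂ i' → i ≡ i'
reduce-injective d₁ d₂ {i} {i'} eq₁ eq₂ = toℕ-injective
  (%-≡-below-lcm⇒≡ d₁ d₂ (toℕ<n i) (toℕ<n i') (residue d₁ eq₁) (residue d₂ eq₂))
  where
  residue : ∀ d .{{_ : NonZero d}} → reduce d i ≡ reduce d i' → toℕ i % d ≡ toℕ i' % d
  residue d eq = trans (sym (toℕ-reduce d i)) (trans (cong toℕ eq) (toℕ-reduce d i'))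

extend : .{{_ : NonZero M}} .{{_ : NonZero N}} → CyclicArray M N k → CyclicArray L K k
extend {M = M} {N = N} A i j = A (reduce M i) (reduce N j)

SamePattern-extend : .{{_ : NonZero M}} .{{_ : NonZero N}} .{{_ : NonZero L}} .{{_ : NonZero K}} →
                     M ∣ L → N ∣ K → (A : CyclicArray M N k) {i i' : Fin L} {j j' : Fin K} →
                     SamePattern m n (extend A) i j i' j' →
                     SamePattern m n A (reduce M i) (reduce N j) (reduce M i') (reduce N j')
SamePattern-extend {M = M} {N = N} {L = L} {K = K} M∣L N∣K A {i} {i'} {j} {j'} same r s r<m s<n = begin
  entryAt A (reduce M i) (reduce N j) r s    ≡⟨ entry i j ⟨
  entryAt (extend A) i j r s                 ≡⟨ same r s r<m s<n ⟩
  entryAt (extend A) i' j' r s               ≡⟨ entry i' j' ⟩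
  entryAt A (reduce M i') (reduce N j') r s  ∎
  where
  entry : (x : Fin L) (y : Fin K) → entryAt (extend A) x y r s ≡ entryAt A (reduce M x) (reduce N y) r s
  entry x y = cong₂ A (reduce-shift M M∣L x r) (reduce-shift N N∣K y s)

_⊗_ : CyclicArray M N k₁ → CyclicArray M N k₂ → CyclicArray M N (k₁ * k₂)
(A ⊗ B) i j = combine (A i j) (B i j)

SamePattern-⊗ : .{{_ : NonZero M}} .{{_ : NonZero N}} →
                (A : CyclicArray M N k₁) (B : CyclicArray M N k₂) {i i' : Fin M} {j j' : Fin N} →
                SamePattern m n (A ⊗ B) i j i' j' →
                SamePattern m n A i j i' j' × SamePattern m n B i j i' j'
SamePattern-⊗ {k₁ = k₁} A B same =
  (λ r s r<m s<n → proj₁ (combine-injective {k₁} _ _ _ _ (same r s r<m s<n))) ,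
  (λ r s r<m s<n → proj₂ (combine-injective {k₁} _ _ _ _ (same r s r<m s<n)))

lemma5 : (M₁ N₁ M₂ N₂ m n k₁ k₂ : ℕ)
         .{{_ : NonZero M₁}} .{{_ : NonZero N₁}}
         .{{_ : NonZero M₂}} .{{_ : NonZero N₂}}
         .{{_ : NonZero (lcm M₁ M₂)}} .{{_ : NonZero (lcm N₁ N₂)}} →
         (A₁ : CyclicArray M₁ N₁ k₁) → SubPerfectMap m n A₁ →
         (A₂ : CyclicArray M₂ N₂ k₂) → SubPerfectMap m n A₂ →
         Σ (CyclicArray (lcm M₁ M₂) (lcm N₁ N₂) (k₁ * k₂))
           (λ A → SubPerfectMap m n A)
lemma5 M₁ N₁ M₂ N₂ m n k₁ k₂ A₁ perfect₁ A₂ perfect₂ = A , perfect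
  where
  A : CyclicArray (lcm M₁ M₂) (lcm N₁ N₂) (k₁ * k₂)
  A = extend A₁ ⊗ extend A₂

  perfect : SubPerfectMap m n A
  perfect i j i' j' same
    with same₁ , same₂ ← SamePattern-⊗ (extend A₁) (extend A₂) same
    with i₁ , j₁ ← perfect₁ _ _ _ _ (SamePattern-extend (m∣lcm[m,n] M₁ M₂) (m∣lcm[m,n] N₁ N₂) A₁ same₁)
    with i₂ , j₂ ← perfect₂ _ _ _ _ (SamePattern-extend (n∣lcm[m,n] M₁ M₂) (n∣lcm[m,n] N₁ N₂) A₂ same₂)
    = reduce-injective M₁ M₂ i₁ i₂ , reduce-injective N₁ N₂ j₁ j₂
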